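{- Let $\{\overrightarrow{AB},\overrightarrow{CD}\}$ be a proper pair of segments. Then $A\neq D$, $C\neq B$, and $B\neq D$.
   Context: Two integer points are adjacent if the segment joining them contains no other integer point; such a segment is called prime. $\mathcal{G}_{m,n}=\{0,\dots,m-1\}\times\{0,\dots,n-1\}$. For distinct points $A,B,C$ the oriented triangle $\overrightarrow{ABC}$ is counterclockwise if the determinant with rows $(a_1,a_2,1),(b_1,b_2,1),(c_1,c_2,1)$ is positive. For adjacent $A,B\in\mathcal{G}_{m,n}$, $f_{\overrightarrow{AB}}:\mathcal{G}_{m,n}\to\{0,1\}$ has $f(A)=1$, $f(B)=0$; for $X$ on the line $\ell(AB)$, $f(X)=1$ iff $d(A,X)<d(B,X)$; for $X\notin\ell(AB)$, $f(X)=1$ iff $\overrightarrow{ABX}$ is counterclockwise. A pair $\{\overrightarrow{AB},\overrightarrow{CD}\}$ is proper if both segments are prime and $f_{\overrightarrow{CD}}(A)=f_{\overrightarrow{CD}}(B)=f_{\overrightarrow{AB}}(C)=f_{\overrightarrow{AB}}(D)=1$. -}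

module Defs where

open import Data.Integer using (ℤ; +_; _+_; _-_; _*_; _<_; _≤_; 0ℤ)
open import Data.Nat using (ℕ)
open import Data.Product using (_×_; _,_; proj₁; proj₂)
open import Data.Sum using (_⊎_)
open import Data.Bool using (Bool; true; false; if_then_else_)
open import Relation.Nullary using (¬_; does)
open import Relation.Binary.PropositionalEquality using (_≡_)
import Data.Integer.Properties as ℤP

Point : Set
Point = ℤ × ℤ

x : Point → ℤ
x = proj₁

y : Point → ℤ
y = proj₂

InGrid : ℕ → ℕ → Point → Set
InGrid m n P = (0ℤ ≤ x P) × (x P < + m) × (0ℤ ≤ y P) × (y P < + n)

-- determinant with rows (a1,a2,1),(b1,b2,1),(c1,c2,1)
det : Point → Point → Point → ℤ
det A B C = ((x B - x A) * (y C - y A)) - ((y B - y A) * (x C - x A))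

OnSegment : Point → Point → Point → Set
OnSegment A B X =
  (det A B X ≡ 0ℤ) ×
  (0ℤ ≤ ((x X - x A) * (x B - x X)) + ((y X - y A) * (y B - y X)))

Adjacent : Point → Point → Set
Adjacent A B = (¬ A ≡ B) × (∀ X → OnSegment A B X → (X ≡ A) ⊎ (X ≡ B))

Prime : Point → Point → Set
Prime = Adjacent

dist² : Point → Point → ℤ
dist² P Q = ((x P - x Q) * (x P - x Q)) + ((y P - y Q) * (y P - y Q))

-- f_{AB}(X) (as a Boolean).  Note f(A)=1 and f(B)=0 follow from the
-- line clause since A, B lie on ℓ(AB).
f : Point → Point → Point → Bool
f A B X =
  if does (det A B X ℤP.≟ 0ℤ)
  then does (dist² A X ℤP.<? dist² B X)
  else does (0ℤ ℤP.<? det A B X)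

Proper : ℕ → ℕ → Point → Point → Point → Point → Set
Proper m n A B C D =
  InGrid m n A × InGrid m n B × InGrid m n C × InGrid m n D ×
  Prime A B × Prime C D ×
  (f C D A ≡ true) × (f C D B ≡ true) × (f A B C ≡ true) × (f A B D ≡ true)

-- Q lies on ℓ(PQ) at squared distance 0 from itself, which no other point
-- undercuts, so f_{PQ}(Q) = 0 for every P: a point where some f_{PQ} is 1 is
-- never the endpoint Q.
module Submission where

open import Defs
open import Data.Bool using (true; false)
open import Data.Empty using (⊥-elim)
open import Data.Integer using (ℤ; _-_; _*_; _<_; _≤_; 0ℤ; +_; -[1+_]; +≤+)
import Data.Integer.Properties as ℤP
open import Data.Nat using (ℕ; suc; z≤n)
open import Data.Product using (_×_; _,_)
open import Relation.Nullary using (¬_; yes; no)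
open import Relation.Binary.PropositionalEquality using (_≡_; refl; subst)

det-endpoint : ∀ P Q → det P Q Q ≡ 0ℤ
det-endpoint P Q
  rewrite ℤP.*-comm (x Q - x P) (y Q - y P) = ℤP.+-inverseʳ ((y Q - y P) * (x Q - x P))

i*i-nonNeg : ∀ (i : ℤ) → 0ℤ ≤ i * i
i*i-nonNeg (+ 0)     = +≤+ z≤n
i*i-nonNeg (+ suc _) = +≤+ z≤n
i*i-nonNeg -[1+ _ ]  = +≤+ z≤n

dist²-nonNeg : ∀ P Q → 0ℤ ≤ dist² P Q
dist²-nonNeg P Q = ℤP.+-mono-≤ (i*i-nonNeg (x P - x Q)) (i*i-nonNeg (y P - y Q))

dist²-self : ∀ Q → dist² Q Q ≡ 0ℤ
dist²-self Q rewrite ℤP.+-inverseʳ (x Q) | ℤP.+-inverseʳ (y Q) = refl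

dist²-≮-self : ∀ P Q → ¬ dist² P Q < dist² Q Q
dist²-≮-self P Q lt =
  ℤP.<-irrefl refl (ℤP.≤-<-trans (dist²-nonNeg P Q) (subst (dist² P Q <_) (dist²-self Q) lt))

f-endpoint : ∀ P Q → f P Q Q ≡ false
f-endpoint P Q with det P Q Q ℤP.≟ 0ℤ
... | no det≢0 = ⊥-elim (det≢0 (det-endpoint P Q))
... | yes _ with dist² P Q ℤP.<? dist² Q Q
...   | no _   = refl
...   | yes lt = ⊥-elim (dist²-≮-self P Q lt)

f≡true⇒≢endpoint : ∀ {P Q X} → f P Q X ≡ true → ¬ X ≡ Q
f≡true⇒≢endpoint {P} {Q} fX refl with () ← subst (_≡ true) (f-endpoint P Q) fX

claim7 : (m n : ℕ) (A B C D : Point) → Proper m n A B C D →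
    (¬ A ≡ D) × (¬ C ≡ B) × (¬ B ≡ D)
claim7 m n A B C D (_ , _ , _ , _ , _ , _ , fA , fB , fC , _) =
  f≡true⇒≢endpoint fA , f≡true⇒≢endpoint fC , f≡true⇒≢endpoint fB
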